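{- Let $j,k$ be positive integers, $H$ a graph, $H''$ a connected induced subgraph of $H$ with at most $j$ vertices, and $H'=H-V(H'')$ with $\chi(H')\leq k$. Suppose $H''$ is $f$-choosable for the function $f(v)=k-d'(v)$, $v\in V(H'')$. Then $g_k(H)\leq g_k(H')+j$.
   Context: For $v\in V(H'')$, $d'(v)=|N_H(v)\cap V(H')|$. Given $f:V(F)\to\mathbb{N}$, an $f$-list assignment $L$ gives each vertex $v$ a list of $f(v)$ positive integers; an $L$-coloring is a proper coloring $\phi$ with $\phi(v)\in L(v)$ for all $v$; $F$ is $f$-choosable if every $f$-list assignment admits an $L$-coloring. For a graph $H$ and $k\geq\chi(H)$, a proper $k$-coloring is a map $V(H)\to[k]$ giving adjacent vertices different colors; $G^j_k(H)$ has the proper $k$-colorings of $H$ as vertices, two distinct colorings adjacent if $H$ contains a connected subgraph on at most $j$ vertices containing all vertices where they differ; $g_k(H)$ is the least $j\geq1$ with $G^j_k(H)$ connected. -}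

module Defs where

open import Data.Nat using (ℕ; zero; suc; _+_; _∸_; _≤_; _<_)
open import Data.Bool using (Bool; true; false; if_then_else_; _∧_; not)
open import Data.Fin using (Fin)
open import Data.List using (List; length; map; allFin)
open import Data.Nat.ListAction using (sum)
open import Data.List.Membership.Propositional using (_∈_)
open import Data.List.Relation.Unary.All using (All)
open import Data.List.Relation.Unary.Unique.Propositional using (Unique)
open import Data.Product using (Σ; ∃; _×_; _,_; proj₁)
open import Data.Unit using (⊤)
open import Relation.Binary.PropositionalEquality using (_≡_; _≢_)
open import Relation.Nullary using (¬_)

record Graph (V : Set) : Set where
  field
    adj    : V → V → Bool
    sym    : ∀ u v → adj u v ≡ adj v u
    irrefl : ∀ v → adj v v ≡ false
open Graph public

Induced : {V : Set} → Graph V → (P : V → Set) → Graph (Σ V P)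
Induced G P = record
  { adj    = λ u v → adj G (proj₁ u) (proj₁ v)
  ; sym    = λ u v → sym G (proj₁ u) (proj₁ v)
  ; irrefl = λ v → irrefl G (proj₁ v) }

data WalkIn {V : Set} (G : Graph V) (S : V → Set) : V → V → Set where
  here : ∀ {u} → S u → WalkIn G S u u
  step : ∀ {u v w} → S u → adj G u v ≡ true → WalkIn G S v w → WalkIn G S u w

IsConnected : {V : Set} → Graph V → Set
IsConnected {V} G = (∃ λ (v : V) → ⊤) × (∀ u w → WalkIn G (λ _ → ⊤) u w)

ProperCol : {V A : Set} → Graph V → (V → A) → Set
ProperCol G c = ∀ u v → adj G u v ≡ true → c u ≢ c v

-- proper k-coloring: colors in [k] ≅ Fin k
Colorable : {V : Set} → ℕ → Graph V → Set
Colorable {V} k G = Σ (V → Fin k) (ProperCol G)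

-- L is an f-list assignment: L v is a set (duplicate-free list) of f v positive integers
IsListAssignment : {V : Set} → (V → ℕ) → (V → List ℕ) → Set
IsListAssignment f L = ∀ v → (length (L v) ≡ f v) × Unique (L v) × All (λ x → 1 ≤ x) (L v)

LColoring : {V : Set} → Graph V → (V → List ℕ) → Set
LColoring {V} G L = Σ (V → ℕ) (λ φ → ProperCol G φ × (∀ v → φ v ∈ L v))

Choosable : {V : Set} → Graph V → (V → ℕ) → Set
Choosable {V} G f = (L : V → List ℕ) → IsListAssignment f L → LColoring G L

-- c and e are adjacent in G^j_k(G): distinct, and some connected subgraph
-- of G on at most j vertices (vertex list S) contains all vertices where they differ
AdjRec : {V : Set} → Graph V → (k j : ℕ) → (V → Fin k) → (V → Fin k) → Set
AdjRec {V} G k j c e =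
  (∃ λ v → c v ≢ e v) ×
  Σ (List V) (λ S →
      Unique S × length S ≤ j ×
      (∀ u w → u ∈ S → w ∈ S → WalkIn G (λ x → x ∈ S) u w) ×
      (∀ v → c v ≢ e v → v ∈ S))

-- path in G^j_k(G) from c to d (colorings compared pointwise at the end)
data RecPath {V : Set} (G : Graph V) (k j : ℕ) : (V → Fin k) → (V → Fin k) → Set where
  done : ∀ {c d} → (∀ v → c v ≡ d v) → RecPath G k j c d
  next : ∀ {c d} (e : V → Fin k) → ProperCol G e → AdjRec G k j c e →
         RecPath G k j e d → RecPath G k j c d

RecConnected : {V : Set} → Graph V → (k j : ℕ) → Set
RecConnected {V} G k j =
  (c d : V → Fin k) → ProperCol G c → ProperCol G d → RecPath G k j c d

-- g = g_k(G): defined for k ≥ χ(G); least j ≥ 1 with G^j_k(G) connected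
IsGk : {V : Set} → ℕ → Graph V → ℕ → Set
IsGk {V} k G g =
  Colorable k G × 1 ≤ g × RecConnected G k g ×
  (∀ i → 1 ≤ i → i < g → ¬ RecConnected G k i)

-- H'' = H[inS], H' = H - V(H'')

InH'' : {n : ℕ} → (Fin n → Bool) → Fin n → Set
InH'' inS v = inS v ≡ true

InH' : {n : ℕ} → (Fin n → Bool) → Fin n → Set
InH' inS v = inS v ≡ false

sizeOf : {n : ℕ} → (Fin n → Bool) → ℕ
sizeOf {n} inS = sum (map (λ v → if inS v then 1 else 0) (allFin n))

dPrime : {n : ℕ} → Graph (Fin n) → (Fin n → Bool) → Fin n → ℕ
dPrime {n} H inS v = sum (map (λ w → if not (inS w) ∧ adj H v w then 1 else 0) (allFin n))

module Submission where

-- Every proper k-colouring of H' extends to one of H: list each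
-- vertex v of H'' with the k - d'(v) colours not used on its H'-neighbours
-- and apply choosability.  Now follow a path in G^{g'}_k(H') step by step,
-- carrying along a proper colouring of H that restricts to the current
-- colouring of H'.  A step e₀ → e recolours a connected set S of at most g'
-- vertices of H'.  If S has no neighbour in H'', keep the colours on H'';
-- otherwise recolour H'' by the extension above, and S ∪ V(H'') is still
-- connected, with at most g' + j vertices.  At the end of the path the
-- two colourings of H agree on H', so they differ only inside the connected
-- set V(H'').  Hence G^{g'+j}_k(H) is connected, and minimality of g_k(H)
-- gives g_k(H) ≤ g' + j.

open import Defs hiding (sym)
open import Data.Nat using (ℕ; _+_; _∸_; _≤_)
open import Data.Fin using (Fin)
open import Data.Bool using (Bool)
open import Data.Product using (proj₁)

open import Axiom.UniquenessOfIdentityProofs using (module Decidable⇒UIP)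
open import Data.Bool using (true; false; if_then_else_; _∧_; not)
import Data.Bool as Bool
open import Data.Empty using (⊥-elim)
open import Data.Fin using (zero; suc; toℕ)
open import Data.Fin.Properties using (toℕ-injective; injective⇒≤; all?; ¬∀⟶∃¬)
import Data.Fin as Fin
open import Data.List using (List; _∷_; []; length; map; allFin; take; filter; lookup; _++_)
open import Data.List.Properties using (length-map; length-take; length-tabulate; length-++)
open import Data.List.Membership.Propositional using (_∈_; _∉_; find; lose)
open import Data.List.Membership.Propositional.Properties
  using (∈-map⁺; ∈-map⁻; ∈-filter⁺; ∈-filter⁻; ∈-allFin; ∈-lookup; ∈-++⁺ˡ; ∈-++⁺ʳ; ∈-++⁻)
open import Data.List.Relation.Binary.Sublist.Propositional.Properties using (take-⊆; Any-resp-⊆)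
open import Data.List.Relation.Unary.All as All using (All)
open import Data.List.Relation.Unary.All.Properties using (map⁺)
open import Data.List.Relation.Unary.AllPairs using (_∷_)
open import Data.List.Relation.Unary.Any using (Any; index; any?)
open import Data.List.Relation.Unary.Any.Properties using (lookup-index)
open import Data.List.Relation.Unary.Unique.Propositional using (Unique)
import Data.List.Relation.Unary.Unique.Propositional.Properties as Unique
import Data.List.Membership.DecPropositional as DecMembership
open import Data.Nat using (suc; s≤s; z≤n; _⊓_)
open import Data.Nat.ListAction using (sum)
open import Data.Nat.Properties
  using (≤-trans; ≤-reflexive; ≤-refl; +-mono-≤; +-suc; m≤m+n; m≤n+m; m≤n+o⇒m∸n≤o; m≤n⇒m⊓n≡m; ≮⇒≥; suc-injective; module ≤-Reasoning)
open import Data.Product using (Σ; ∃; _×_; _,_; proj₂)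
open import Data.Sum using (_⊎_; inj₁; inj₂)
open import Function.Definitions using (Injective)
open import Relation.Nullary using (Dec; yes; no)
open import Relation.Unary using (Decidable)
open import Relation.Unary.Properties using (∁?)
open import Relation.Binary.PropositionalEquality using (_≡_; _≢_; refl; sym; trans; cong; cong₂; subst; module ≡-Reasoning)

open Decidable⇒UIP Bool._≟_ using (≡-irrelevant)

select : {A : Set} → (A → Bool) → List A → List A
select b = filter (λ x → b x Bool.≟ true)

length-select : {A : Set} (b : A → Bool) (xs : List A) →
  length (select b xs) ≡ sum (map (λ x → if b x then 1 else 0) xs)
length-select b [] = refl
length-select b (x ∷ xs) with b x
... | true  = cong suc (length-select b xs)
... | false = length-select b xs

length-partition : {A : Set} {P : A → Set} (P? : Decidable P) (xs : List A) →
  length xs ≡ length (filter P? xs) + length (filter (∁? P?) xs)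
length-partition P? [] = refl
length-partition P? (x ∷ xs) with P? x
... | yes _ = cong suc (length-partition P? xs)
... | no _  = trans (cong suc (length-partition P? xs)) (sym (+-suc _ _))

unique-lookup-injective : {A : Set} {xs : List A} → Unique xs →
  ∀ {i j} → lookup xs i ≡ lookup xs j → i ≡ j
unique-lookup-injective (x≢ ∷ u) {zero}  {zero}  _  = refl
unique-lookup-injective (x≢ ∷ u) {zero}  {suc j} eq = ⊥-elim (All.lookup x≢ (∈-lookup j) eq)
unique-lookup-injective (x≢ ∷ u) {suc i} {zero}  eq = ⊥-elim (All.lookup x≢ (∈-lookup i) (sym eq))
unique-lookup-injective (x≢ ∷ u) {suc i} {suc j} eq = cong suc (unique-lookup-injective u eq)

unique-⊆-length : {A : Set} {xs ys : List A} → Unique xs →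
  (∀ {x} → x ∈ xs → x ∈ ys) → length xs ≤ length ys
unique-⊆-length {xs = xs} {ys} u sub = injective⇒≤ {f = position} position-injective
  where
    position : Fin (length xs) → Fin (length ys)
    position i = index (sub (∈-lookup i))

    position-injective : Injective _≡_ _≡_ position
    position-injective {i} {j} eq = unique-lookup-injective u (begin
      lookup xs i            ≡⟨ lookup-index (sub (∈-lookup i)) ⟩
      lookup ys (position i) ≡⟨ cong (lookup ys) eq ⟩
      lookup ys (position j) ≡⟨ sym (lookup-index (sub (∈-lookup j))) ⟩
      lookup xs j            ∎)
      where open ≡-Reasoning

SetConnected : {V : Set} → Graph V → List V → Set
SetConnected G S = ∀ u w → u ∈ S → w ∈ S → WalkIn G (λ x → x ∈ S) u w

module Walks {V : Set} (G : Graph V) where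

  walk-start : ∀ {S : V → Set} {u w} → WalkIn G S u w → S u
  walk-start (here s)     = s
  walk-start (step s _ _) = s

  walk-++ : ∀ {S : V → Set} {u v w} → WalkIn G S u v → WalkIn G S v w → WalkIn G S u w
  walk-++ (here _)     q = q
  walk-++ (step s a p) q = step s a (walk-++ p q)

  walk-reverse : ∀ {S : V → Set} {u w} → WalkIn G S u w → WalkIn G S w u
  walk-reverse (here s) = here s
  walk-reverse {u = u} (step {v = v} s a p) =
    walk-++ (walk-reverse p) (step (walk-start p) (trans (Graph.sym G v u) a) (here s))

  walk-weaken : ∀ {S R : V → Set} {u w} → (∀ x → S x → R x) → WalkIn G S u w → WalkIn G R u w
  walk-weaken f (here s)     = here (f _ s)
  walk-weaken f (step s a p) = step (f _ s) a (walk-weaken f p)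

  connected-bridge : ∀ {S T s t} → SetConnected G S → SetConnected G T →
    s ∈ S → t ∈ T → adj G s t ≡ true → SetConnected G (S ++ T)
  connected-bridge {S} {T} {s} {t} cS cT s∈S t∈T st = connect
    where
      inS : ∀ {u w} → WalkIn G (λ x → x ∈ S) u w → WalkIn G (λ x → x ∈ S ++ T) u w
      inS = walk-weaken (λ _ → ∈-++⁺ˡ)
      inT : ∀ {u w} → WalkIn G (λ x → x ∈ T) u w → WalkIn G (λ x → x ∈ S ++ T) u w
      inT = walk-weaken (λ _ → ∈-++⁺ʳ S)
      across : ∀ u w → u ∈ S → w ∈ T → WalkIn G (λ x → x ∈ S ++ T) u w
      across u w u∈S w∈T =
        walk-++ (inS (cS u s u∈S s∈S)) (step (∈-++⁺ˡ s∈S) st (inT (cT t w t∈T w∈T)))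
      connect : SetConnected G (S ++ T)
      connect u w u∈ w∈ with ∈-++⁻ S u∈ | ∈-++⁻ S w∈
      ... | inj₁ u∈S | inj₁ w∈S = inS (cS u w u∈S w∈S)
      ... | inj₂ u∈T | inj₂ w∈T = inT (cT u w u∈T w∈T)
      ... | inj₁ u∈S | inj₂ w∈T = across u w u∈S w∈T
      ... | inj₂ u∈T | inj₁ w∈S = walk-reverse (across w u w∈S u∈T)

walk-project : {V : Set} (G : Graph V) {P : V → Set} {Q : Σ V P → Set} {R : V → Set} {u w : Σ V P} →
  (∀ x → Q x → R (proj₁ x)) → WalkIn (Induced G P) Q u w → WalkIn G R (proj₁ u) (proj₁ w)
walk-project G f (here q)     = here (f _ q)
walk-project G f (step q a p) = step (f _ q) a (walk-project G f p)

connected-project : {V : Set} (G : Graph V) {P : V → Set} {S : List (Σ V P)} →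
  SetConnected (Induced G P) S → SetConnected G (map proj₁ S)
connected-project G cS u w u∈ w∈ with ∈-map⁻ proj₁ u∈ | ∈-map⁻ proj₁ w∈
... | u' , u'∈ , refl | w' , w'∈ , refl = walk-project G (λ _ → ∈-map⁺ proj₁) (cS u' w' u'∈ w'∈)

DiffersWithin : {V A : Set} → (V → A) → (V → A) → List V → Set
DiffersWithin c e S = ∀ v → c v ≢ e v → v ∈ S

-- S is a connected set of at most J vertices without repetition: the
-- kind of vertex set that one step of G^J_k may recolour.
Region : {V : Set} → Graph V → ℕ → List V → Set
Region G J S = Unique S × length S ≤ J × SetConnected G S

region-weaken : {V : Set} {G : Graph V} {J J' : ℕ} {S : List V} →
  J ≤ J' → Region G J S → Region G J' S
region-weaken J≤J' (u , l , w) = u , ≤-trans l J≤J' , w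

module Reconfiguration {V : Set} (G : Graph V) (k J : ℕ) where

  adj-respˡ : ∀ {c d e} → (∀ v → c v ≡ d v) → AdjRec G k J d e → AdjRec G k J c e
  adj-respˡ c≗d ((v , dv≢ev) , S , u , l , w , diff) =
    (v , λ eq → dv≢ev (trans (sym (c≗d v)) eq)) , S , u , l , w ,
    (λ x cx≢ex → diff x (λ eq → cx≢ex (trans (c≗d x) eq)))

  rec-trans : ∀ {c d e} → RecPath G k J c d → RecPath G k J d e → RecPath G k J c e
  rec-trans (done c≗d) (done d≗e)         = done (λ v → trans (c≗d v) (d≗e v))
  rec-trans (done c≗d) (next e pe a rest) = next e pe (adj-respˡ c≗d a) rest
  rec-trans (next e pe a rest) q          = next e pe a (rec-trans rest q)

rec-move : {n k J : ℕ} (G : Graph (Fin n)) (c e : Fin n → Fin k) → ProperCol G e →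
  (S : List (Fin n)) → Region G J S → DiffersWithin c e S → RecPath G k J c e
rec-move {n} G c e pe S (u , l , w) diff with all? (λ v → c v Fin.≟ e v)
... | yes same = done same
... | no differ =
  next e pe (¬∀⟶∃¬ n _ (λ v → c v Fin.≟ e v) differ , S , u , l , w , diff) (done (λ _ → refl))

true≢false : true ≢ false
true≢false ()

module Glue {V : Set} (side : V → Bool) where

  Outer Inner : Set
  Outer = Σ V (λ v → side v ≡ false)
  Inner = Σ V (λ v → side v ≡ true)

  glueAt : {A : Set} → (Outer → A) → (Inner → A) → (v : V) (s : Bool) → side v ≡ s → A
  glueAt a b v false p = a (v , p)
  glueAt a b v true  p = b (v , p)

  glue : {A : Set} → (Outer → A) → (Inner → A) → V → A
  glue a b v = glueAt a b v (side v) refl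

  glue-outer : {A : Set} (a : Outer → A) (b : Inner → A) →
    ∀ v (p : side v ≡ false) → glue a b v ≡ a (v , p)
  glue-outer a b v p = at (side v) refl
    where
      at : ∀ s (q : side v ≡ s) → glueAt a b v s q ≡ a (v , p)
      at false q = cong (λ r → a (v , r)) (≡-irrelevant q p)
      at true  q = ⊥-elim (true≢false (trans (sym q) p))

  glue-inner : {A : Set} (a : Outer → A) (b : Inner → A) →
    ∀ v (p : side v ≡ true) → glue a b v ≡ b (v , p)
  glue-inner a b v p = at (side v) refl
    where
      at : ∀ s (q : side v ≡ s) → glueAt a b v s q ≡ b (v , p)
      at true  q = cong (λ r → b (v , r)) (≡-irrelevant q p)
      at false q = ⊥-elim (true≢false (trans (sym p) q))

  glue-cases : {A : Set} (a : Outer → A) (b : Inner → A) → ∀ v →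
    (∃ λ p → glue a b v ≡ a (v , p)) ⊎ (∃ λ p → glue a b v ≡ b (v , p))
  glue-cases a b v = by-side (side v) refl
    where
      by-side : ∀ s → side v ≡ s →
        (∃ λ p → glue a b v ≡ a (v , p)) ⊎ (∃ λ p → glue a b v ≡ b (v , p))
      by-side false p = inj₁ (p , glue-outer a b v p)
      by-side true  p = inj₂ (p , glue-inner a b v p)

  Compatible : {A : Set} → Graph V → (Outer → A) → (Inner → A) → Set
  Compatible G a b = ∀ x y → adj G (proj₁ x) (proj₁ y) ≡ true → a x ≢ b y

  glue-proper : {A : Set} (G : Graph V) (a : Outer → A) (b : Inner → A) →
    ProperCol (Induced G (λ v → side v ≡ false)) a →
    ProperCol (Induced G (λ v → side v ≡ true)) b →
    Compatible G a b → ProperCol G (glue a b)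
  glue-proper G a b pa pb compat u v uv eq with glue-cases a b u | glue-cases a b v
  ... | inj₁ (pu , gu) | inj₁ (pv , gv) = pa (u , pu) (v , pv) uv (trans (sym gu) (trans eq gv))
  ... | inj₂ (pu , gu) | inj₂ (pv , gv) = pb (u , pu) (v , pv) uv (trans (sym gu) (trans eq gv))
  ... | inj₁ (pu , gu) | inj₂ (pv , gv) = compat (u , pu) (v , pv) uv (trans (sym gu) (trans eq gv))
  ... | inj₂ (pu , gu) | inj₁ (pv , gv) =
    compat (v , pv) (u , pu) (trans (Graph.sym G v u) uv) (sym (trans (sym gu) (trans eq gv)))

restrict-proper : {V A : Set} (G : Graph V) {P : V → Set} {c : V → A} →
  ProperCol G c → ProperCol (Induced G P) (λ x → c (proj₁ x))
restrict-proper G pc u v uv = pc (proj₁ u) (proj₁ v) uv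

module Decomposition {n : ℕ} (H : Graph (Fin n)) (inS : Fin n → Bool) where

  open Glue inS using (Outer; Inner; glue; glue-outer; glue-cases; Compatible; glue-proper)
  open Walks H using (connected-bridge)

  H' : Graph Outer
  H' = Induced H (InH' inS)

  H'' : Graph Inner
  H'' = Induced H (InH'' inS)

  Extends : {k : ℕ} → (Fin n → Fin k) → (Outer → Fin k) → Set
  Extends C e = ∀ x → C (proj₁ x) ≡ e x

  inner : List (Fin n)
  inner = select inS (allFin n)

  inner-complete : ∀ v → inS v ≡ true → v ∈ inner
  inner-complete v p = ∈-filter⁺ (λ x → inS x Bool.≟ true) (∈-allFin v) p

  inner-sound : ∀ {v} → v ∈ inner → inS v ≡ true
  inner-sound m = proj₂ (∈-filter⁻ (λ x → inS x Bool.≟ true) {xs = allFin n} m)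

  inner-region : ∀ {J} → IsConnected H'' → sizeOf inS ≤ J → Region H J inner
  inner-region (_ , walks) small =
    Unique.filter⁺ _ (Unique.allFin⁺ n) ,
    ≤-trans (≤-reflexive (length-select inS (allFin n))) small ,
    λ u w u∈ w∈ → walk-project H (λ x _ → inner-complete (proj₁ x) (proj₂ x))
                    (walks (u , inner-sound u∈) (w , inner-sound w∈))

  outer-injective : ∀ {x y : Outer} → proj₁ x ≡ proj₁ y → x ≡ y
  outer-injective {v , p} {.v , q} refl = cong (v ,_) (≡-irrelevant p q)

  outer-region : ∀ {J} {S' : List Outer} → Region H' J S' → Region H J (map proj₁ S')
  outer-region {S' = S'} (u , l , w) =
    Unique.map⁺ outer-injective u , ≤-trans (≤-reflexive (length-map proj₁ S')) l , connected-project H w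

  outer-not-inner : ∀ {S' : List Outer} {v} → v ∈ map proj₁ S' → v ∉ inner
  outer-not-inner v∈ v∈inner with ∈-map⁻ proj₁ v∈
  ... | (_ , p) , _ , refl = true≢false (trans (sym (inner-sound v∈inner)) p)

  Contact : List (Fin n) → Set
  Contact S = Any (λ s → Any (λ w → adj H s w ≡ true) inner) S

  contact? : (S : List (Fin n)) → Dec (Contact S)
  contact? = any? (λ s → any? (λ w → adj H s w Bool.≟ true) inner)

  join-region : ∀ {J J'} {S' : List Outer} → Region H J (map proj₁ S') → Region H J' inner →
    Contact (map proj₁ S') → Region H (J + J') (map proj₁ S' ++ inner)
  join-region {S' = S'} (uS , lS , cS) (uI , lI , cI) touch =
    Unique.++⁺ uS uI (λ (v∈S , v∈inner) → outer-not-inner v∈S v∈inner) ,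
    ≤-trans (≤-reflexive (length-++ (map proj₁ S'))) (+-mono-≤ lS lI) ,
    connected-bridge cS cI s∈S w∈inner sw
    where
      s-contact = find touch
      s∈S = proj₁ (proj₂ s-contact)
      neighbour = find (proj₂ (proj₂ s-contact))
      w∈inner = proj₁ (proj₂ neighbour)
      sw = proj₂ (proj₂ neighbour)

  -- Any colouring A of the vertices of H' extends to a proper colouring of
  -- H'' without conflicts along edges between H' and H'': give v in H'' the
  -- list of k - d'(v) colours not used by A on the H'-neighbours of v.
  module Extension {k : ℕ} (ch : Choosable H'' (λ x → k ∸ dPrime H inS (proj₁ x))) (A : Fin n → Fin k) where
    open DecMembership (Fin._≟_ {k}) using (_∈?_)

    outerNeighbours : Fin n → List (Fin n)
    outerNeighbours v = select (λ w → not (inS w) ∧ adj H v w) (allFin n)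

    usedAt : Fin n → List (Fin k)
    usedAt v = map A (outerNeighbours v)

    usedAt-complete : ∀ (x : Outer) v → adj H v (proj₁ x) ≡ true → A (proj₁ x) ∈ usedAt v
    usedAt-complete (u , pu) v vu = ∈-map⁺ A (∈-filter⁺ _ (∈-allFin u) (cong₂ _∧_ (cong not pu) vu))

    freeAt : Fin n → List (Fin k)
    freeAt v = filter (∁? (_∈? usedAt v)) (allFin k)

    -- at most d'(v) colours are used, so at least k - d'(v) are free
    length-freeAt : ∀ v → k ∸ dPrime H inS v ≤ length (freeAt v)
    length-freeAt v = m≤n+o⇒m∸n≤o k (dPrime H inS v) (begin
      k                                                          ≡⟨ sym (length-tabulate {n = k} (λ i → i)) ⟩
      length (allFin k)                                          ≡⟨ length-partition (_∈? usedAt v) (allFin k) ⟩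
      length (filter (_∈? usedAt v) (allFin k)) + length (freeAt v) ≤⟨ +-mono-≤ used-bound ≤-refl ⟩
      dPrime H inS v + length (freeAt v)                         ∎)
      where
        open ≤-Reasoning
        used-bound : length (filter (_∈? usedAt v) (allFin k)) ≤ dPrime H inS v
        used-bound = begin
          length (filter (_∈? usedAt v) (allFin k)) ≤⟨ unique-⊆-length (Unique.filter⁺ _ (Unique.allFin⁺ k))
                                                                      (λ m → proj₂ (∈-filter⁻ _ {xs = allFin k} m)) ⟩
          length (usedAt v)                          ≡⟨ length-map A (outerNeighbours v) ⟩
          length (outerNeighbours v)                 ≡⟨ length-select _ (allFin n) ⟩
          dPrime H inS v                             ∎

    -- colours as the positive integers of a list assignment
    encode : Fin k → ℕ
    encode i = suc (toℕ i)

    encode-injective : ∀ {i i'} → encode i ≡ encode i' → i ≡ i'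
    encode-injective eq = toℕ-injective (suc-injective eq)

    lists : Inner → List ℕ
    lists x = map encode (take (k ∸ dPrime H inS (proj₁ x)) (freeAt (proj₁ x)))

    lists-assignment : IsListAssignment (λ x → k ∸ dPrime H inS (proj₁ x)) lists
    lists-assignment (v , p) = size , Unique.map⁺ encode-injective (Unique.take⁺ m free-unique) , positive
      where
        open ≡-Reasoning
        m = k ∸ dPrime H inS v
        free-unique : Unique (freeAt v)
        free-unique = Unique.filter⁺ _ (Unique.allFin⁺ k)
        size : length (lists (v , p)) ≡ m
        size = begin
          length (map encode (take m (freeAt v))) ≡⟨ length-map encode (take m (freeAt v)) ⟩
          length (take m (freeAt v))              ≡⟨ length-take m (freeAt v) ⟩
          m ⊓ length (freeAt v)                   ≡⟨ m≤n⇒m⊓n≡m (length-freeAt v) ⟩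
          m                                       ∎
        positive : All (λ c → 1 ≤ c) (lists (v , p))
        positive = map⁺ (All.tabulate (λ _ → s≤s z≤n))

    extension : Σ (Inner → Fin k) λ b → ProperCol H'' b × Compatible H (λ x → A (proj₁ x)) b
    extension = b , proper , avoids
      where
        coloring = ch lists lists-assignment
        φ = proj₁ coloring

        decode : ∀ x → ∃ λ i → i ∈ take (k ∸ dPrime H inS (proj₁ x)) (freeAt (proj₁ x)) × φ x ≡ encode i
        decode x = ∈-map⁻ encode (proj₂ (proj₂ coloring) x)

        b : Inner → Fin k
        b x = proj₁ (decode x)

        proper : ProperCol H'' b
        proper x y xy eq = proj₁ (proj₂ coloring) x y xy
          (trans (proj₂ (proj₂ (decode x))) (trans (cong encode eq) (sym (proj₂ (proj₂ (decode y))))))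

        free : ∀ x → b x ∉ usedAt (proj₁ x)
        free x = proj₂ (∈-filter⁻ _ {xs = allFin k} (Any-resp-⊆ (take-⊆ _ _) (proj₁ (proj₂ (decode x)))))

        avoids : Compatible H (λ x → A (proj₁ x)) b
        avoids x y xy eq = free y (subst (_∈ usedAt (proj₁ y)) eq
          (usedAt-complete x (proj₁ y) (trans (Graph.sym H (proj₁ y) (proj₁ x)) xy)))

  module Lifting {k g' j : ℕ} (connected : IsConnected H'') (small : sizeOf inS ≤ j)
                 (ch : Choosable H'' (λ x → k ∸ dPrime H inS (proj₁ x))) where
    open Reconfiguration H k (g' + j) using (rec-trans)

    Follows : (Fin n → Fin k) → (Outer → Fin k) → Set
    Follows C e = Σ (Fin n → Fin k) λ C₁ → ProperCol H C₁ × Extends C₁ e × RecPath H k (g' + j) C C₁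

    glue-step : ∀ {e₀ e} (C : Fin n → Fin k) → Extends C e₀ → ProperCol H' e →
      (b : Inner → Fin k) → ProperCol H'' b → Compatible H e b →
      (R : List (Fin n)) → Region H (g' + j) R →
      (∀ x → e₀ x ≢ e x → proj₁ x ∈ R) → (∀ x → C (proj₁ x) ≢ b x → proj₁ x ∈ R) → Follows C e
    glue-step {e₀} {e} C ext pe b pb compat R region outer-diff inner-diff =
      glue e b , proper , (λ x → glue-outer e b (proj₁ x) (proj₂ x)) , rec-move H C (glue e b) proper R region differs
      where
        proper : ProperCol H (glue e b)
        proper = glue-proper H e b pe pb compat
        differs : DiffersWithin C (glue e b) R
        differs v ne with glue-cases e b v
        ... | inj₁ (p , gv) = outer-diff (v , p) (λ eq → ne (trans (ext (v , p)) (trans eq (sym gv))))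
        ... | inj₂ (p , gv) = inner-diff (v , p) (λ eq → ne (trans eq (sym gv)))

    lift-step : ∀ {e₀ e} → ProperCol H' e → AdjRec H' k g' e₀ e →
      (C : Fin n → Fin k) → ProperCol H C → Extends C e₀ → Follows C e
    lift-step {e₀} {e} pe (_ , S' , u' , l' , w' , diff') C pC ext = by-contact (contact? S)
      where
        S = map proj₁ S'
        S-region : Region H g' S
        S-region = outer-region (u' , l' , w')
        in-S : ∀ x → e₀ x ≢ e x → proj₁ x ∈ S
        in-S x ne = ∈-map⁺ proj₁ (diff' x ne)

        by-contact : Dec (Contact S) → Follows C e
        -- S has no neighbour in H'': keep the colours of C on H''
        by-contact (no apart) =
          glue-step C ext pe (λ y → C (proj₁ y)) (restrict-proper H pC) compat S
            (region-weaken (m≤m+n g' j) S-region) in-S (λ _ ne → ⊥-elim (ne refl))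
          where
            compat : Compatible H e (λ y → C (proj₁ y))
            compat x y xy eq with e₀ x Fin.≟ e x
            ... | yes same = pC (proj₁ x) (proj₁ y) xy (trans (ext x) (trans same eq))
            ... | no differ = apart (lose (in-S x differ) (lose (inner-complete (proj₁ y) (proj₂ y)) xy))
        -- S touches H'': recolour H'' by the extension, inside the connected region S ∪ V(H'')
        by-contact (yes touch) =
          glue-step C ext pe b pb compat (S ++ inner) region in-S′ (λ y _ → ∈-++⁺ʳ S (inner-complete (proj₁ y) (proj₂ y)))
          where
            open Extension ch (glue e (λ y → C (proj₁ y))) using (extension)
            b = proj₁ extension
            pb = proj₁ (proj₂ extension)
            compat : Compatible H e b
            compat x y xy eq = proj₂ (proj₂ extension) x y xy (trans (glue-outer e _ (proj₁ x) (proj₂ x)) eq)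
            in-S′ : ∀ x → e₀ x ≢ e x → proj₁ x ∈ S ++ inner
            in-S′ x ne = ∈-++⁺ˡ (in-S x ne)
            region : Region H (g' + j) (S ++ inner)
            region = join-region S-region (inner-region connected small) touch

    -- Colourings of H that agree on H' differ only inside the connected set V(H'').
    close-gap : (C D : Fin n → Fin k) → ProperCol H D → (∀ (x : Outer) → C (proj₁ x) ≡ D (proj₁ x)) →
      RecPath H k (g' + j) C D
    close-gap C D pD agree = rec-move H C D pD inner (region-weaken (m≤n+m j g') (inner-region connected small)) differs
      where
        differs : DiffersWithin C D inner
        differs v ne with inS v in p
        ... | true  = inner-complete v p
        ... | false = ⊥-elim (ne (agree (v , p)))

    lift-path : ∀ {e₀ eₑ} → RecPath H' k g' e₀ eₑ →
      (C : Fin n → Fin k) → ProperCol H C → Extends C e₀ →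
      (D : Fin n → Fin k) → ProperCol H D → Extends D eₑ → RecPath H k (g' + j) C D
    lift-path (done same) C _ extC D pD extD =
      close-gap C D pD (λ x → trans (extC x) (trans (same x) (sym (extD x))))
    lift-path (next e pe e₀→e rest) C pC extC D pD extD =
      let (C₁ , pC₁ , extC₁ , C→C₁) = lift-step pe e₀→e C pC extC
      in rec-trans C→C₁ (lift-path rest C₁ pC₁ extC₁ D pD extD)

    lift-connected : RecConnected H' k g' → RecConnected H k (g' + j)
    lift-connected connected' c d pc pd =
      lift-path (connected' (λ x → c (proj₁ x)) (λ x → d (proj₁ x)) (restrict-proper H pc) (restrict-proper H pd))
        c pc (λ _ → refl) d pd (λ _ → refl)

mainTheorem5 : (j k : ℕ) → 1 ≤ j → 1 ≤ k →
    (n : ℕ) (H : Graph (Fin n)) (inS : Fin n → Bool) →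
    IsConnected (Induced H (InH'' inS)) →
    sizeOf inS ≤ j →
    Colorable k (Induced H (InH' inS)) →
    Choosable (Induced H (InH'' inS)) (λ v → k ∸ dPrime H inS (proj₁ v)) →
    (g' g : ℕ) → IsGk k (Induced H (InH' inS)) g' → IsGk k H g →
    g ≤ g' + j
mainTheorem5 j k 1≤j _ n H inS connected small _ ch g' g (_ , _ , connected' , _) (_ , _ , _ , minimal) =
  ≮⇒≥ λ g'+j<g → minimal (g' + j) (≤-trans 1≤j (m≤n+m j g')) g'+j<g (lift-connected connected')
  where open Decomposition.Lifting H inS {k} {g'} {j} connected small ch
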